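{- For every odd positive integer $n > 3$, we have $h_2(n) \geq 2$.
   Context: For a prime power $q$ and $n \in \mathbb{N}$, let $\sigma:\mathbb{F}_q^n\to\mathbb{F}_q^n$ be the cyclic shift $\sigma(\sum_{i=1}^n x_i e_i)=\sum_{i=1}^n x_{i-1}e_i$ (indices mod $n$), where $e_1,\dots,e_n$ is the standard basis. A subspace $U\le \mathbb{F}_q^n$ is cyclically covering if $\bigcup_{r=0}^{n-1}\sigma^r(U)=\mathbb{F}_q^n$. $h_q(n)$ denotes the maximum possible codimension of a cyclically covering subspace of $\mathbb{F}_q^n$. -}

module Defs where

open import Data.Nat using (ℕ; zero; suc; _∸_; _≤_)
open import Data.Fin using (Fin; zero; suc; fromℕ; inject₁)
open import Data.Bool using (Bool; false; true; _xor_; _∧_)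
open import Data.Product using (Σ; ∃; _×_; _,_)
open import Relation.Binary.PropositionalEquality using (_≡_)

-- F₂ is modelled by Bool (addition = xor, multiplication = ∧).
-- Vectors of F₂ⁿ are functions Fin n → Bool.
Vect : ℕ → Set
Vect n = Fin n → Bool

_≈_ : {n : ℕ} → Vect n → Vect n → Set
x ≈ y = ∀ i → x i ≡ y i

𝟘 : {n : ℕ} → Vect n
𝟘 _ = false

_⊕_ : {n : ℕ} → Vect n → Vect n → Vect n
(x ⊕ y) i = x i xor y i

_·_ : {n : ℕ} → Bool → Vect n → Vect n
(c · x) i = c ∧ x i

prevIx : {n : ℕ} → Fin n → Fin n
prevIx {suc m} zero    = fromℕ m
prevIx {suc m} (suc i) = inject₁ i

-- cyclic shift σ(Σ xᵢ eᵢ) = Σ x_{i-1} eᵢ, i.e. (σ x)ᵢ = x_{i-1}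
σ : {n : ℕ} → Vect n → Vect n
σ x i = x (prevIx i)

σ^ : {n : ℕ} → ℕ → Vect n → Vect n
σ^ zero    x = x
σ^ (suc r) x = σ (σ^ r x)

-- A subspace of F₂ⁿ: a subset containing 0 and closed under addition
-- (closure under scalars is automatic over F₂), respecting ≈.
record Subspace (n : ℕ) : Set₁ where
  field
    _∈U    : Vect n → Set
    resp   : ∀ {x y} → x ≈ y → x ∈U → y ∈U
    zero∈  : 𝟘 ∈U
    add∈   : ∀ {x y} → x ∈U → y ∈U → (x ⊕ y) ∈U
open Subspace public

lincomb : {n d : ℕ} → (Fin d → Bool) → (Fin d → Vect n) → Vect n
lincomb {d = zero}  c v = 𝟘
lincomb {d = suc d} c v = (c zero · v zero) ⊕ lincomb (λ i → c (suc i)) (λ i → v (suc i))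

LinIndep : {n d : ℕ} → (Fin d → Vect n) → Set
LinIndep {d = d} v = ∀ (c : Fin d → Bool) → lincomb c v ≈ 𝟘 → ∀ i → c i ≡ false

IsBasis : {n d : ℕ} → Subspace n → (Fin d → Vect n) → Set
IsBasis {d = d} U v =
  (∀ i → _∈U U (v i)) × LinIndep v ×
  (∀ x → _∈U U x → Σ (Fin d → Bool) λ c → lincomb c v ≈ x)

HasDim : {n : ℕ} → Subspace n → ℕ → Set
HasDim {n} U d = Σ (Fin d → Vect n) λ v → IsBasis U v

HasCodim : {n : ℕ} → Subspace n → ℕ → Set
HasCodim {n} U k = Σ ℕ λ d → HasDim U d × k ≡ n ∸ d

CyclicallyCovering : {n : ℕ} → Subspace n → Set
CyclicallyCovering {n} U =
  ∀ (x : Vect n) → Σ (Fin n) λ r → Σ (Vect n) λ u → _∈U U u × σ^ (Data.Fin.toℕ r) u ≈ x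

-- k ≤ h₂(n): since h₂(n) is the maximum codimension of a cyclically
-- covering subspace, this says some cyclically covering subspace has codim ≥ k.
_≤h₂_ : ℕ → ℕ → Set₁
k ≤h₂ n = Σ (Subspace n) λ U → CyclicallyCovering U × Σ ℕ λ c → HasCodim U c × k ≤ c

-- Take U = {u : u₀ = u₃, u₁ = u₂}, of codimension 2. Since σʳ u = x for u = (x_r, x_{r+1}, …),
-- x is covered as soon as the cyclic word x has a palindrome x_r x_{r+1} x_{r+2} x_{r+3}.
-- If it has none, then around each position i+1 where x agrees with its successor exactly one
-- neighbouring position agrees as well, so agreements come in adjacent pairs and are even in
-- number; disagreements are even in number too, since x returns to its start. Hence n is even.
-- Over F₂ both counts are telescoping sums: with aᵢ = [xᵢ = xᵢ₊₁] and bᵢ = aᵢ aᵢ₊₁,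
-- n = Σ (aᵢ + xᵢ + xᵢ₊₁) = Σ aᵢ = Σ aᵢ₊₁ = Σ (bᵢ + bᵢ₊₁) = 0.
module Submission where

open import Defs
open import Data.Nat using (ℕ; suc; _*_; _<_)
open import Relation.Binary.PropositionalEquality using (_≡_)

open import Algebra.Bundles using (CommutativeRing)
open import Data.Bool using (Bool; true; false; not; _xor_; _∧_)
open import Data.Bool.Properties as Bool
  using (xor-assoc; xor-same; xor-identityʳ; ∧-identityʳ; ∧-zeroʳ)
open import Data.Fin using (Fin; zero; suc; toℕ; fromℕ; fromℕ<; _↑ʳ_; #_)
open import Data.Fin.Properties using (_≟_; toℕ-fromℕ; toℕ-inject₁; toℕ<n; fromℕ<-cong; fromℕ<-toℕ; any?)
open import Data.Nat using (zero; _+_; z≤n; s≤s)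
open import Data.Nat.DivMod using (_mod_; _%_; [m+n]%n≡m%n; m<n⇒m%n≡m)
open import Data.Nat.Properties using (+-suc; +-comm; +-identityʳ; *-suc; m+n∸n≡m; ≤-refl)
open import Data.Product using (Σ; _×_; _,_)
open import Relation.Nullary using (¬_; Dec; does; yes; no; contradiction)
open import Relation.Nullary.Decidable using (_×-dec_)
open import Algebra.Properties.CommutativeSemigroup (CommutativeRing.+-commutativeSemigroup Bool.xor-∧-commutativeRing)
  using () renaming (interchange to xor-interchange)
open import Relation.Binary.PropositionalEquality using (refl; sym; trans; cong; cong₂; subst; module ≡-Reasoning)

⨁ : {d : ℕ} → (Fin d → Bool) → Bool
⨁ {zero}  g = false
⨁ {suc d} g = g zero xor ⨁ (λ i → g (suc i))

⨁-cong : {d : ℕ} {g h : Fin d → Bool} → (∀ i → g i ≡ h i) → ⨁ g ≡ ⨁ h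
⨁-cong {zero}  e = refl
⨁-cong {suc d} e = cong₂ _xor_ (e zero) (⨁-cong (λ i → e (suc i)))

⨁-false : (d : ℕ) → ⨁ {d} (λ _ → false) ≡ false
⨁-false zero    = refl
⨁-false (suc d) = ⨁-false d

⨁-xor : {d : ℕ} (g h : Fin d → Bool) → ⨁ (λ i → g i xor h i) ≡ ⨁ g xor ⨁ h
⨁-xor {zero}  g h = refl
⨁-xor {suc d} g h =
  trans (cong ((g zero xor h zero) xor_) (⨁-xor (λ i → g (suc i)) (λ i → h (suc i))))
        (xor-interchange (g zero) (h zero) _ _)

⨁-telescope : (d : ℕ) (g : ℕ → Bool) → ⨁ {d} (λ i → g (toℕ i) xor g (suc (toℕ i))) ≡ g 0 xor g d
⨁-telescope zero    g = sym (xor-same (g 0))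
⨁-telescope (suc d) g = begin
  (g 0 xor g 1) xor ⨁ {d} (λ i → g (suc (toℕ i)) xor g (suc (suc (toℕ i))))
    ≡⟨ cong ((g 0 xor g 1) xor_) (⨁-telescope d (λ j → g (suc j))) ⟩
  (g 0 xor g 1) xor (g 1 xor g (suc d))
    ≡⟨ xor-assoc (g 0) (g 1) _ ⟩
  g 0 xor (g 1 xor (g 1 xor g (suc d)))
    ≡⟨ cong (g 0 xor_) (sym (xor-assoc (g 1) (g 1) _)) ⟩
  g 0 xor ((g 1 xor g 1) xor g (suc d))
    ≡⟨ cong (λ b → g 0 xor (b xor g (suc d))) (xor-same (g 1)) ⟩
  g 0 xor g (suc d) ∎
  where open ≡-Reasoning

unit : {n : ℕ} → Fin n → Vect n
unit i j = does (j ≟ i)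

⨁-select : {d : ℕ} (c : Fin d → Bool) (i : Fin d) → ⨁ (λ j → c j ∧ unit j i) ≡ c i
⨁-select {suc d} c zero =
  trans (cong ((c zero ∧ true) xor_) (⨁-cong (λ j → ∧-zeroʳ (c (suc j)))))
        (trans (cong₂ _xor_ (∧-identityʳ (c zero)) (⨁-false d)) (xor-identityʳ (c zero)))
⨁-select {suc d} c (suc i) =
  trans (cong (_xor ⨁ (λ j → c (suc j) ∧ unit j i)) (∧-zeroʳ (c zero)))
        (⨁-select (λ j → c (suc j)) i)

⨁-true-odd : (k : ℕ) → ⨁ {suc (2 * k)} (λ _ → true) ≡ true
⨁-true-odd zero    = refl
⨁-true-odd (suc k) =
  subst (λ n → ⨁ {suc n} (λ _ → true) ≡ true) (sym (*-suc 2 k)) (cong (λ b → not (not b)) (⨁-true-odd k))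

Periodic : ℕ → (ℕ → Bool) → Set
Periodic N g = ∀ j → g (j + N) ≡ g j

⨁-telescope-periodic : {N : ℕ} {g : ℕ → Bool} → Periodic N g →
                       ⨁ {N} (λ i → g (toℕ i) xor g (suc (toℕ i))) ≡ false
⨁-telescope-periodic {N} {g} per =
  trans (⨁-telescope N g) (trans (cong (g 0 xor_) (per 0)) (xor-same (g 0)))

⨁-shift-periodic : {N : ℕ} {g : ℕ → Bool} → Periodic N g →
                   ⨁ {N} (λ i → g (suc (toℕ i))) ≡ ⨁ {N} (λ i → g (toℕ i))
⨁-shift-periodic {N} {g} per = begin
  ⨁ {N} (λ i → g (suc (toℕ i)))
    ≡⟨ ⨁-cong {N} (λ i → xor-cancelˡ (g (toℕ i)) (g (suc (toℕ i)))) ⟩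
  ⨁ {N} (λ i → g (toℕ i) xor (g (toℕ i) xor g (suc (toℕ i))))
    ≡⟨ ⨁-xor {N} _ _ ⟩
  ⨁ {N} (λ i → g (toℕ i)) xor ⨁ {N} (λ i → g (toℕ i) xor g (suc (toℕ i)))
    ≡⟨ cong (⨁ {N} (λ i → g (toℕ i)) xor_) (⨁-telescope-periodic per) ⟩
  ⨁ {N} (λ i → g (toℕ i)) xor false
    ≡⟨ xor-identityʳ _ ⟩
  ⨁ {N} (λ i → g (toℕ i)) ∎
  where
  open ≡-Reasoning
  xor-cancelˡ : ∀ a b → b ≡ a xor (a xor b)
  xor-cancelˡ a b = sym (trans (sym (xor-assoc a a b)) (cong (_xor b) (xor-same a)))

Palindrome₄ : (ℕ → Bool) → ℕ → Set
Palindrome₄ f s = f s ≡ f (3 + s) × f (1 + s) ≡ f (2 + s)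

palindrome₄? : (f : ℕ → Bool) (s : ℕ) → Dec (Palindrome₄ f s)
palindrome₄? f s = (f s Bool.≟ f (3 + s)) ×-dec (f (1 + s) Bool.≟ f (2 + s))

module _ (f : ℕ → Bool) where

  agree : ℕ → Bool
  agree i = not (f i xor f (suc i))

  agree₂ : ℕ → Bool
  agree₂ i = agree i ∧ agree (suc i)

  agree-split : ∀ i → ¬ Palindrome₄ f i → agree (suc i) ≡ agree₂ i xor agree₂ (suc i)
  agree-split i = split (f i) (f (1 + i)) (f (2 + i)) (f (3 + i))
    where
    split : ∀ w x y z → ¬ (w ≡ z × x ≡ y) →
            not (x xor y) ≡ (not (w xor x) ∧ not (x xor y)) xor (not (x xor y) ∧ not (y xor z))
    split false false false false ¬p = contradiction (refl , refl) ¬p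
    split false false false true  ¬p = refl
    split false false true  false ¬p = refl
    split false false true  true  ¬p = refl
    split false true  false false ¬p = refl
    split false true  false true  ¬p = refl
    split false true  true  false ¬p = contradiction (refl , refl) ¬p
    split false true  true  true  ¬p = refl
    split true  false false false ¬p = refl
    split true  false false true  ¬p = contradiction (refl , refl) ¬p
    split true  false true  false ¬p = refl
    split true  false true  true  ¬p = refl
    split true  true  false false ¬p = refl
    split true  true  false true  ¬p = refl
    split true  true  true  false ¬p = refl
    split true  true  true  true  ¬p = contradiction (refl , refl) ¬p

  module _ {N : ℕ} (per : Periodic N f) where

    agree-periodic : Periodic N agree
    agree-periodic j = cong₂ (λ a b → not (a xor b)) (per j) (per (suc j))

    agree₂-periodic : Periodic N agree₂
    agree₂-periodic j = cong₂ _∧_ (agree-periodic j) (agree-periodic (suc j))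

    noPalindrome⇒⨁-true≡false : (∀ (i : Fin N) → ¬ Palindrome₄ f (toℕ i)) → ⨁ {N} (λ _ → true) ≡ false
    noPalindrome⇒⨁-true≡false none = begin
      ⨁ {N} (λ _ → true)
        ≡⟨ xor-identityʳ _ ⟨
      ⨁ {N} (λ _ → true) xor false
        ≡⟨ cong (⨁ {N} (λ _ → true) xor_) (⨁-telescope-periodic per) ⟨
      ⨁ {N} (λ _ → true) xor ⨁ {N} (λ i → f (toℕ i) xor f (suc (toℕ i)))
        ≡⟨ ⨁-xor {N} _ _ ⟨
      ⨁ {N} (λ i → agree (toℕ i))
        ≡⟨ ⨁-shift-periodic agree-periodic ⟨
      ⨁ {N} (λ i → agree (suc (toℕ i)))
        ≡⟨ ⨁-cong {N} (λ i → agree-split (toℕ i) (none i)) ⟩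
      ⨁ {N} (λ i → agree₂ (toℕ i) xor agree₂ (suc (toℕ i)))
        ≡⟨ ⨁-telescope-periodic agree₂-periodic ⟩
      false ∎
      where open ≡-Reasoning

window : {n : ℕ} → (ℕ → Bool) → ℕ → Vect n
window f s j = f (toℕ j + s)

module _ {M : ℕ} {f : ℕ → Bool} (per : Periodic (suc M) f) where

  σ-window : ∀ s → σ (window {suc M} f (suc s)) ≈ window f s
  σ-window s zero = begin
    f (toℕ (fromℕ M) + suc s) ≡⟨ cong (λ t → f (t + suc s)) (toℕ-fromℕ M) ⟩
    f (M + suc s)             ≡⟨ cong f (trans (+-suc M s) (+-comm (suc M) s)) ⟩
    f (s + suc M)             ≡⟨ per s ⟩
    f s                       ∎
    where open ≡-Reasoning
  σ-window s (suc j) = cong f (trans (cong (_+ suc s) (toℕ-inject₁ j)) (+-suc (toℕ j) s))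

  σ^-window : ∀ r s → σ^ r (window {suc M} f (s + r)) ≈ window f s
  σ^-window zero    s i = cong (λ t → f (toℕ i + t)) (+-identityʳ s)
  σ^-window (suc r) s i rewrite +-suc s r = trans (σ^-window r (suc s) (prevIx i)) (σ-window s i)

cyclic : {M : ℕ} → Vect (suc M) → ℕ → Bool
cyclic {M} x j = x (j mod suc M)

cyclic-periodic : {M : ℕ} (x : Vect (suc M)) → Periodic (suc M) (cyclic x)
cyclic-periodic {M} x j = cong x (fromℕ<-cong _ _ ([m+n]%n≡m%n j (suc M)) _ _)

window-cyclic : {M : ℕ} (x : Vect (suc M)) → window (cyclic x) 0 ≈ x
window-cyclic {M} x i = cong x (begin
  (toℕ i + 0) mod suc M
    ≡⟨ fromℕ<-cong _ _ (trans (cong (_% suc M) (+-identityʳ (toℕ i))) (m<n⇒m%n≡m (toℕ<n i))) _ (toℕ<n i) ⟩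
  fromℕ< (toℕ<n i)
    ≡⟨ fromℕ<-toℕ i _ ⟩
  i ∎)
  where open ≡-Reasoning

lincomb-apply : {n d : ℕ} (c : Fin d → Bool) (v : Fin d → Vect n) (i : Fin n) →
                lincomb c v i ≡ ⨁ (λ l → c l ∧ v l i)
lincomb-apply {d = zero}  c v i = refl
lincomb-apply {d = suc d} c v i =
  cong ((c zero ∧ v zero i) xor_) (lincomb-apply (λ l → c (suc l)) (λ l → v (suc l)) i)

module _ (m : ℕ) where

  PalindromicPrefix : Vect (4 + m) → Set
  PalindromicPrefix u = u (# 0) ≡ u (# 3) × u (# 1) ≡ u (# 2)

  palindromicPrefix : Subspace (4 + m)
  palindromicPrefix = record
    { _∈U   = PalindromicPrefix
    ; resp  = λ e (p , q) → trans (sym (e _)) (trans p (e _)) , trans (sym (e _)) (trans q (e _))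
    ; zero∈ = refl , refl
    ; add∈  = λ (p , q) (p′ , q′) → cong₂ _xor_ p p′ , cong₂ _xor_ q q′
    }

  basis : Fin (2 + m) → Vect (4 + m)
  basis zero          = unit (# 0) ⊕ unit (# 3)
  basis (suc zero)    = unit (# 1) ⊕ unit (# 2)
  basis (suc (suc j)) = unit (4 ↑ʳ j)

  coordinate : Fin (2 + m) → Fin (4 + m)
  coordinate zero          = # 0
  coordinate (suc zero)    = # 1
  coordinate (suc (suc j)) = 4 ↑ʳ j

  fromCoordinates : (Fin (2 + m) → Bool) → Vect (4 + m)
  fromCoordinates c zero                      = c (# 0)
  fromCoordinates c (suc zero)                = c (# 1)
  fromCoordinates c (suc (suc zero))          = c (# 1)
  fromCoordinates c (suc (suc (suc zero)))    = c (# 0)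
  fromCoordinates c (suc (suc (suc (suc i)))) = c (suc (suc i))

  lincomb-basis : (c : Fin (2 + m) → Bool) → lincomb c basis ≈ fromCoordinates c
  lincomb-basis c i = trans (lincomb-apply c basis i) (evaluate i)
    where
    vanish : ⨁ (λ j → c (suc (suc j)) ∧ false) ≡ false
    vanish = trans (⨁-cong (λ j → ∧-zeroʳ (c (suc (suc j))))) (⨁-false m)
    first : ∀ a b {r} → r ≡ false → a ∧ true xor (b ∧ false xor r) ≡ a
    first a b refl rewrite ∧-identityʳ a | ∧-zeroʳ b = xor-identityʳ a
    second : ∀ a b {r} → r ≡ false → a ∧ false xor (b ∧ true xor r) ≡ b
    second a b refl rewrite ∧-identityʳ b | ∧-zeroʳ a = xor-identityʳ b
    neither : ∀ a b {r} → a ∧ false xor (b ∧ false xor r) ≡ r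
    neither a b rewrite ∧-zeroʳ a | ∧-zeroʳ b = refl
    evaluate : (i : Fin (4 + m)) → ⨁ (λ l → c l ∧ basis l i) ≡ fromCoordinates c i
    evaluate zero                      = first  (c (# 0)) (c (# 1)) vanish
    evaluate (suc zero)                = second (c (# 0)) (c (# 1)) vanish
    evaluate (suc (suc zero))          = second (c (# 0)) (c (# 1)) vanish
    evaluate (suc (suc (suc zero)))    = first  (c (# 0)) (c (# 1)) vanish
    evaluate (suc (suc (suc (suc i)))) =
      trans (neither (c (# 0)) (c (# 1))) (⨁-select (λ j → c (suc (suc j))) i)

  fromCoordinates-coordinate : (c : Fin (2 + m) → Bool) (l : Fin (2 + m)) → fromCoordinates c (coordinate l) ≡ c l
  fromCoordinates-coordinate c zero          = refl
  fromCoordinates-coordinate c (suc zero)    = refl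
  fromCoordinates-coordinate c (suc (suc j)) = refl

  fromCoordinates-coordinate⁻¹ : (x : Vect (4 + m)) → PalindromicPrefix x → fromCoordinates (λ l → x (coordinate l)) ≈ x
  fromCoordinates-coordinate⁻¹ x (p , q) zero                      = refl
  fromCoordinates-coordinate⁻¹ x (p , q) (suc zero)                = refl
  fromCoordinates-coordinate⁻¹ x (p , q) (suc (suc zero))          = q
  fromCoordinates-coordinate⁻¹ x (p , q) (suc (suc (suc zero)))    = p
  fromCoordinates-coordinate⁻¹ x (p , q) (suc (suc (suc (suc i)))) = refl

  basis-isBasis : IsBasis palindromicPrefix basis
  basis-isBasis = basis∈ , independent , spanning
    where
    basis∈ : ∀ l → PalindromicPrefix (basis l)
    basis∈ zero          = refl , refl
    basis∈ (suc zero)    = refl , refl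
    basis∈ (suc (suc j)) = refl , refl
    independent : LinIndep basis
    independent c c·basis≈0 l = begin
      c l                                        ≡⟨ fromCoordinates-coordinate c l ⟨
      fromCoordinates c (coordinate l)           ≡⟨ lincomb-basis c (coordinate l) ⟨
      lincomb c basis (coordinate l)             ≡⟨ c·basis≈0 (coordinate l) ⟩
      false                                      ∎
      where open ≡-Reasoning
    spanning : ∀ x → PalindromicPrefix x → Σ (Fin (2 + m) → Bool) λ c → lincomb c basis ≈ x
    spanning x x∈ = (λ l → x (coordinate l)) , λ i →
      trans (lincomb-basis _ i) (fromCoordinates-coordinate⁻¹ x x∈ i)

  palindromicPrefix-codim : HasCodim palindromicPrefix 2
  palindromicPrefix-codim = 2 + m , (basis , basis-isBasis) , sym (m+n∸n≡m 2 m)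

  palindromicPrefix-covering : (k : ℕ) → 4 + m ≡ suc (2 * k) → CyclicallyCovering palindromicPrefix
  palindromicPrefix-covering k odd x with any? (λ r → palindrome₄? (cyclic x) (toℕ r))
  ... | yes (r , palindrome) =
    r , window (cyclic x) (toℕ r) , palindrome ,
    λ i → trans (σ^-window (cyclic-periodic x) (toℕ r) 0 i) (window-cyclic x i)
  ... | no ¬palindrome = contradiction (trans (sym ⨁-true) ⨁-true≡false) λ ()
    where
    ⨁-true : ⨁ {4 + m} (λ _ → true) ≡ true
    ⨁-true = subst (λ n → ⨁ {n} (λ _ → true) ≡ true) (sym odd) (⨁-true-odd k)
    ⨁-true≡false : ⨁ {4 + m} (λ _ → true) ≡ false
    ⨁-true≡false = noPalindrome⇒⨁-true≡false (cyclic x) (cyclic-periodic x) λ r p → ¬palindrome (r , p)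

lemma2p1 : (n k : ℕ) → n ≡ suc (2 * k) → 3 < n → 2 ≤h₂ n
lemma2p1 _ k odd (s≤s (s≤s (s≤s (s≤s {n = m} z≤n)))) =
  palindromicPrefix m , palindromicPrefix-covering m k odd , 2 , palindromicPrefix-codim m , ≤-refl
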